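{- Let $G$ be a graph with $\delta(G) \geq 2$ and let $H$ be a connected asymmetric spanning subgraph of $G$. If $H$ has an almost majority coloring with $a$ colors, then $M'_D(G) \leq a+3$.
   Context: Graphs are finite, simple and undirected. An asymmetric spanning subgraph $H$ of $G$ is a subgraph with $V(H)=V(G)$ whose only automorphism is the identity. An almost majority edge coloring of a graph $H$ is an edge coloring such that for every vertex of degree at least two, at most half of the edges incident with it have the same color (edges incident with vertices of degree one may have any color). A majority edge coloring is an edge coloring such that for every vertex $u$ and every color $\alpha$, at most half of the edges incident with $u$ have color $\alpha$. An edge coloring is distinguishing if the only automorphism $\varphi$ of $G$ with $c(\varphi(u)\varphi(v))=c(uv)$ for all edges $uv$ is the identity. $M'_D(G)$ is the least number of colors in an edge coloring of $G$ that is both majority and distinguishing. -}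

module Defs where

open import Data.Nat using (ℕ; zero; suc; _+_; _*_; _≤_)
open import Data.Bool using (Bool; true; false; _∧_; if_then_else_)
open import Data.Fin using (Fin; zero; suc; _≟_)
open import Data.Fin.Permutation using (Permutation′; _⟨$⟩ʳ_)
open import Data.Product using (Σ; _×_)
open import Relation.Nullary.Decidable using (⌊_⌋)
open import Relation.Binary.PropositionalEquality using (_≡_)

record Graph (n : ℕ) : Set where
  field
    adj   : Fin n → Fin n → Bool
    sym   : ∀ u v → adj u v ≡ adj v u
    irref : ∀ u → adj u u ≡ false
open Graph public

count : ∀ {n} → (Fin n → Bool) → ℕ
count {zero}  p = 0
count {suc n} p = (if p zero then 1 else 0) + count (λ x → p (suc x))

degree : ∀ {n} → Graph n → Fin n → ℕ
degree G u = count (λ v → adj G u v)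

-- An edge colouring with k colours: a colour for each ordered pair,
-- symmetric on edges (only values on edges are relevant).
record EdgeColoring {n : ℕ} (G : Graph n) (k : ℕ) : Set where
  field
    col    : Fin n → Fin n → Fin k
    colSym : ∀ u v → adj G u v ≡ true → col u v ≡ col v u
open EdgeColoring public

colorDegree : ∀ {n k} {G : Graph n} → EdgeColoring G k → Fin n → Fin k → ℕ
colorDegree {G = G} c u α = count (λ v → adj G u v ∧ ⌊ col c u v ≟ α ⌋)

IsMajority : ∀ {n k} {G : Graph n} → EdgeColoring G k → Set
IsMajority {G = G} c = ∀ u α → 2 * colorDegree c u α ≤ degree G u

IsAlmostMajority : ∀ {n k} {G : Graph n} → EdgeColoring G k → Set
IsAlmostMajority {G = G} c =
  ∀ u → 2 ≤ degree G u → ∀ α → 2 * colorDegree c u α ≤ degree G u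

IsAutomorphism : ∀ {n} → Graph n → Permutation′ n → Set
IsAutomorphism G φ = ∀ u v → adj G (φ ⟨$⟩ʳ u) (φ ⟨$⟩ʳ v) ≡ adj G u v

IsIdentity : ∀ {n} → Permutation′ n → Set
IsIdentity φ = ∀ u → φ ⟨$⟩ʳ u ≡ u

IsAsymmetric : ∀ {n} → Graph n → Set
IsAsymmetric G = ∀ φ → IsAutomorphism G φ → IsIdentity φ

IsDistinguishing : ∀ {n k} {G : Graph n} → EdgeColoring G k → Set
IsDistinguishing {G = G} c =
  ∀ φ → IsAutomorphism G φ →
  (∀ u v → adj G u v ≡ true → col c (φ ⟨$⟩ʳ u) (φ ⟨$⟩ʳ v) ≡ col c u v) →
  IsIdentity φ

SpanningSubgraph : ∀ {n} → Graph n → Graph n → Set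
SpanningSubgraph H G = ∀ u v → adj H u v ≡ true → adj G u v ≡ true

data Walk {n} (G : Graph n) : Fin n → Fin n → Set where
  here : ∀ {u} → Walk G u u
  step : ∀ {u v w} → adj G u v ≡ true → Walk G v w → Walk G u w

-- connected (the empty graph counts as connected vacuously)
Connected : ∀ {n} → Graph n → Set
Connected G = ∀ u v → Walk G u v

MinDegreeAtLeast : ∀ {n} → Graph n → ℕ → Set
MinDegreeAtLeast G d = ∀ u → d ≤ degree G u

-- M'_D(G) ≤ k : some edge colouring with (at most) k colours is
-- majority and distinguishing
MD'≤ : ∀ {n} → Graph n → ℕ → Set
MD'≤ G k = Σ (EdgeColoring G k) (λ c → IsMajority c × IsDistinguishing c)

-- Split G into H and F = G ∖ H. Colour H with the given a colours and F with
-- three further colours so that at every vertex each colour covers at most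
-- (deg_F + 1)/2 of the F-edges; such a colouring exists for every graph, by
-- deleting a vertex, colouring the rest inductively, and giving each edge at the
-- deleted vertex the less used of two colours that are light at its other end
-- (with three colours at most one colour is heavy there). Since H is connected
-- and spanning, deg_H ≥ 1, so deg_F + 1 ≤ deg_G; and δ(G) ≥ 2 covers the
-- vertices of H-degree one. A colour-preserving automorphism of G maps H-edges
-- to H-edges, hence is an automorphism of the asymmetric H.
module Submission where

open import Defs hiding (sym)
open import Data.Nat using (ℕ; zero; suc; _+_; _*_; _≤_; _≤?_; z≤n; s≤s)
open import Data.Nat.Properties
  using (≤-refl; ≤-trans; ≤-pred; m≤n+m; n≤1+n; ≰⇒≥; ≰⇒>; <⇒≱; +-comm; +-identityʳ; *-suc;
         *-distribˡ-+; +-mono-≤; +-monoʳ-≤; +-mono-<; *-monoʳ-≤; +-commutativeSemigroup;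
         module ≤-Reasoning)
open import Algebra.Properties.CommutativeSemigroup +-commutativeSemigroup using (interchange)
open import Data.Bool using (Bool; true; false; _∧_; not; if_then_else_)
open import Data.Fin using (Fin; zero; suc; _≟_; _↑ˡ_; _↑ʳ_; splitAt)
open import Data.Fin.Properties
  using (↑ˡ-injective; ↑ʳ-injective; splitAt-↑ˡ; splitAt-↑ʳ; splitAt⁻¹-↑ˡ; splitAt⁻¹-↑ʳ)
open import Data.Fin.Patterns using (0F; 1F; 2F)
open import Data.Fin.Permutation using (_⟨$⟩ʳ_)
open import Data.Product using (Σ; _×_; _,_; proj₁; proj₂; ∃)
open import Data.Sum using (_⊎_; inj₁; inj₂)
open import Data.Empty using (⊥-elim)
open import Function using (_∘_)
open import Relation.Nullary using (¬_; yes; no; contradiction)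
open import Relation.Nullary.Decidable using (⌊_⌋)
open import Relation.Binary.PropositionalEquality

indicator : Bool → ℕ
indicator b = if b then 1 else 0

indicator≤1 : ∀ b → indicator b ≤ 1
indicator≤1 true  = ≤-refl
indicator≤1 false = z≤n

indicator-∧ˡ : ∀ b x → indicator (b ∧ x) ≤ indicator b
indicator-∧ˡ true  x = indicator≤1 x
indicator-∧ˡ false x = z≤n

indicator-∧ʳ : ∀ b x → indicator (b ∧ x) ≤ indicator x
indicator-∧ʳ true  x = ≤-refl
indicator-∧ʳ false x = z≤n

count-mono : ∀ {n} {p q : Fin n → Bool} →
  (∀ x → indicator (p x) ≤ indicator (q x)) → count p ≤ count q
count-mono {zero}  p≤q = z≤n
count-mono {suc n} p≤q = +-mono-≤ (p≤q zero) (count-mono (p≤q ∘ suc))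

count-+ : ∀ {n} {p q r : Fin n → Bool} →
  (∀ x → indicator (p x) + indicator (q x) ≤ indicator (r x)) → count p + count q ≤ count r
count-+ {zero}  p+q≤r = z≤n
count-+ {suc n} {p} {q} {r} p+q≤r = begin
  count p + count q
    ≡⟨ interchange (indicator (p zero)) (count (p ∘ suc)) (indicator (q zero)) (count (q ∘ suc)) ⟩
  (indicator (p zero) + indicator (q zero)) + (count (p ∘ suc) + count (q ∘ suc))
    ≤⟨ +-mono-≤ (p+q≤r zero) (count-+ (p+q≤r ∘ suc)) ⟩
  count r ∎
  where open ≤-Reasoning

∃⇒count≥1 : ∀ {n} {p : Fin n → Bool} x → p x ≡ true → 1 ≤ count p
∃⇒count≥1 {suc n} {p} zero    px rewrite px = s≤s z≤n
∃⇒count≥1 {suc n} {p} (suc x) px =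
  ≤-trans (∃⇒count≥1 x px) (m≤n+m (count (p ∘ suc)) (indicator (p zero)))

count≥1⇒∃ : ∀ {n} (p : Fin n → Bool) → 1 ≤ count p → ∃ λ x → p x ≡ true
count≥1⇒∃ {suc n} p h with p zero in p0
... | true  = zero , p0
... | false = let (x , px) = count≥1⇒∃ (p ∘ suc) h in suc x , px

countOf : ∀ {n k} → (Fin n → Bool) → (Fin n → Fin k) → Fin k → ℕ
countOf b g γ = count (λ j → b j ∧ ⌊ g j ≟ γ ⌋)

countOf≤count : ∀ {n k} (b : Fin n → Bool) (g : Fin n → Fin k) γ → countOf b g γ ≤ count b
countOf≤count b g γ = count-mono (λ j → indicator-∧ˡ (b j) _)

countOf-disjoint : ∀ {n k} (b : Fin n → Bool) (g : Fin n → Fin k) {x y} → x ≢ y →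
  countOf b g x + countOf b g y ≤ count b
countOf-disjoint b g {x} {y} x≢y = count-+ pointwise
  where
  pointwise : ∀ j →
    indicator (b j ∧ ⌊ g j ≟ x ⌋) + indicator (b j ∧ ⌊ g j ≟ y ⌋) ≤ indicator (b j)
  pointwise j with b j | g j ≟ x | g j ≟ y
  ... | false | _        | _        = z≤n
  ... | true  | yes refl | yes refl = contradiction refl x≢y
  ... | true  | yes _    | no _     = ≤-refl
  ... | true  | no _     | yes _    = ≤-refl
  ... | true  | no _     | no _     = z≤n

double≤ : ∀ {x y t} → x ≤ y → x + y ≤ t → 2 * x ≤ t
double≤ {x} {y} {t} x≤y x+y≤t = begin
  2 * x       ≡⟨ cong (x +_) (+-identityʳ x) ⟩
  x + x       ≤⟨ +-monoʳ-≤ x x≤y ⟩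
  x + y       ≤⟨ x+y≤t ⟩
  t ∎
  where open ≤-Reasoning

double-suc : ∀ {x t} → 2 * x ≤ t → 2 * suc x ≤ suc t + 1
double-suc {x} {t} 2x≤t = begin
  2 * suc x   ≡⟨ *-suc 2 x ⟩
  2 + 2 * x   ≤⟨ +-monoʳ-≤ 2 2x≤t ⟩
  2 + t       ≡⟨ cong suc (+-comm 1 t) ⟩
  suc t + 1 ∎
  where open ≤-Reasoning

lighterOf : ∀ {A : Set} (c : A → ℕ) (x y : A) {t} → c x + c y ≤ t →
  ∃ λ z → (z ≡ x ⊎ z ≡ y) × 2 * c z ≤ t
lighterOf c x y {t} cx+cy≤t with c x ≤? c y
... | yes cx≤cy = x , inj₁ refl , double≤ cx≤cy cx+cy≤t
... | no  cx≰cy = y , inj₂ refl , double≤ (≰⇒≥ cx≰cy) (subst (_≤ t) (+-comm (c x) (c y)) cx+cy≤t)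

bothHeavy⇒sumHeavy : ∀ x y {t} → ¬ 2 * x ≤ t → ¬ 2 * y ≤ t → ¬ x + y ≤ t
bothHeavy⇒sumHeavy x y {t} hx hy x+y≤t = <⇒≱ (+-mono-< (≰⇒> hx) (≰⇒> hy)) (begin
  2 * x + 2 * y ≡⟨ *-distribˡ-+ 2 x y ⟨
  2 * (x + y)   ≤⟨ *-monoʳ-≤ 2 x+y≤t ⟩
  2 * t         ≡⟨ cong (t +_) (+-identityʳ t) ⟩
  t + t ∎)
  where open ≤-Reasoning

record LightPair {k} (c : Fin k → ℕ) (t : ℕ) : Set where
  constructor lightPair
  field
    first second  : Fin k
    distinct      : first ≢ second
    first-light   : 2 * c first ≤ t
    second-light  : 2 * c second ≤ t

twoLightColours : (c : Fin 3 → ℕ) (t : ℕ) → (∀ x y → x ≢ y → c x + c y ≤ t) → LightPair c t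
twoLightColours c t disjoint with 2 * c 0F ≤? t | 2 * c 1F ≤? t | 2 * c 2F ≤? t
... | yes l₀ | yes l₁ | _      = lightPair 0F 1F (λ ()) l₀ l₁
... | yes l₀ | no  _  | yes l₂ = lightPair 0F 2F (λ ()) l₀ l₂
... | no  _  | yes l₁ | yes l₂ = lightPair 1F 2F (λ ()) l₁ l₂
... | yes _  | no  h₁ | no  h₂ = ⊥-elim (bothHeavy⇒sumHeavy (c 1F) (c 2F) h₁ h₂ (disjoint 1F 2F λ ()))
... | no  h₀ | yes _  | no  h₂ = ⊥-elim (bothHeavy⇒sumHeavy (c 0F) (c 2F) h₀ h₂ (disjoint 0F 2F λ ()))
... | no  h₀ | no  h₁ | _      = ⊥-elim (bothHeavy⇒sumHeavy (c 0F) (c 1F) h₀ h₁ (disjoint 0F 1F λ ()))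

addEdge-bound : ∀ {k} (b : Bool) (z γ : Fin k) (c : Fin k → ℕ) {t} →
  2 * c z ≤ t → 2 * c γ ≤ t + 1 →
  2 * (indicator (b ∧ ⌊ z ≟ γ ⌋) + c γ) ≤ indicator b + t + 1
addEdge-bound false z γ c light bound = bound
addEdge-bound true  z γ c light bound with z ≟ γ
... | yes refl = double-suc light
... | no  _    = ≤-trans bound (n≤1+n _)

record BalancedChoice {m k} (b : Fin m → Bool) (p q : Fin m → Fin k) : Set where
  field
    choice    : Fin m → Fin k
    choice∈   : ∀ j → choice j ≡ p j ⊎ choice j ≡ q j
    balanced  : ∀ γ → 2 * countOf b choice γ ≤ count b + 1

balancedChoice : ∀ {m k} (b : Fin m → Bool) (p q : Fin m → Fin k) → (∀ j → p j ≢ q j) →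
  BalancedChoice b p q
balancedChoice {zero}      b p q p≢q = record { choice = λ () ; choice∈ = λ () ; balanced = λ _ → z≤n }
balancedChoice {suc m} {k} b p q p≢q = record { choice = g ; choice∈ = g∈pq ; balanced = g-balanced }
  where
  rest : BalancedChoice (b ∘ suc) (p ∘ suc) (q ∘ suc)
  rest = balancedChoice (b ∘ suc) (p ∘ suc) (q ∘ suc) (p≢q ∘ suc)
  open BalancedChoice rest

  used : Fin k → ℕ
  used = countOf (b ∘ suc) choice

  lighter : ∃ λ z → (z ≡ p zero ⊎ z ≡ q zero) × 2 * used z ≤ count (b ∘ suc)
  lighter = lighterOf used (p zero) (q zero) (countOf-disjoint (b ∘ suc) choice (p≢q zero))

  g : Fin (suc m) → Fin k
  g zero    = proj₁ lighter
  g (suc j) = choice j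

  g∈pq : ∀ j → g j ≡ p j ⊎ g j ≡ q j
  g∈pq zero    = proj₁ (proj₂ lighter)
  g∈pq (suc j) = choice∈ j

  g-balanced : ∀ γ → 2 * countOf b g γ ≤ count b + 1
  g-balanced γ = addEdge-bound (b zero) (g zero) γ used (proj₂ (proj₂ lighter)) (balanced γ)

IsNearMajority : ∀ {n k} {G : Graph n} → EdgeColoring G k → Set
IsNearMajority {G = G} c = ∀ u α → 2 * colorDegree c u α ≤ degree G u + 1

deleteZero : ∀ {n} → Graph (suc n) → Graph n
deleteZero G = record
  { adj   = λ u v → adj G (suc u) (suc v)
  ; sym   = λ u v → Graph.sym G (suc u) (suc v)
  ; irref = λ u → irref G (suc u)
  }

nearMajority3 : ∀ {n} (G : Graph n) → Σ (EdgeColoring G 3) IsNearMajority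
nearMajority3 {zero}  G = record { col = λ () ; colSym = λ () } , λ ()
nearMajority3 {suc n} G = C , nearMajority
  where
  G′ : Graph n
  G′ = deleteZero G

  rest : Σ (EdgeColoring G′ 3) IsNearMajority
  rest = nearMajority3 G′

  c′ : EdgeColoring G′ 3
  c′ = proj₁ rest

  light : ∀ i → LightPair (colorDegree c′ i) (degree G′ i)
  light i = twoLightColours (colorDegree c′ i) (degree G′ i)
    (λ x y → countOf-disjoint (adj G′ i) (col c′ i))

  open LightPair

  atZero : BalancedChoice (adj G zero ∘ suc) (first ∘ light) (second ∘ light)
  atZero = balancedChoice (adj G zero ∘ suc) (first ∘ light) (second ∘ light) (distinct ∘ light)
  open BalancedChoice atZero renaming (choice to g)

  g-light : ∀ i → 2 * colorDegree c′ i (g i) ≤ degree G′ i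
  g-light i with choice∈ i
  ... | inj₁ g≡p rewrite g≡p = first-light (light i)
  ... | inj₂ g≡q rewrite g≡q = second-light (light i)

  col₀ : Fin (suc n) → Fin (suc n) → Fin 3
  col₀ zero    zero    = 0F
  col₀ zero    (suc j) = g j
  col₀ (suc i) zero    = g i
  col₀ (suc i) (suc j) = col c′ i j

  col₀-sym : ∀ u v → adj G u v ≡ true → col₀ u v ≡ col₀ v u
  col₀-sym zero    zero    _ = refl
  col₀-sym zero    (suc j) _ = refl
  col₀-sym (suc i) zero    _ = refl
  col₀-sym (suc i) (suc j) e = colSym c′ i j e

  C : EdgeColoring G 3
  C = record { col = col₀ ; colSym = col₀-sym }

  nearMajority : IsNearMajority C
  nearMajority zero γ rewrite irref G zero = balanced γ
  nearMajority (suc i) γ =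
    addEdge-bound (adj G (suc i) zero) (g i) γ (colorDegree c′ i) (g-light i) (proj₂ rest i γ)

_∖_ : ∀ {n} → Graph n → Graph n → Graph n
G ∖ H = record
  { adj   = λ u v → adj G u v ∧ not (adj H u v)
  ; sym   = λ u v → cong₂ (λ g h → g ∧ not h) (Graph.sym G u v) (Graph.sym H u v)
  ; irref = λ u → cong (_∧ not (adj H u u)) (irref G u)
  }

module _ {n} {G H : Graph n} (H⊆G : SpanningSubgraph H G) where

  nonadjacent-spanning : ∀ {u v} → adj G u v ≡ false → adj H u v ≡ false
  nonadjacent-spanning {u} {v} uv∉G with adj H u v in uv∈H
  ... | false = refl
  ... | true  = trans (sym (H⊆G u v uv∈H)) uv∉G

  degree-∖-+ : ∀ u → degree (G ∖ H) u + degree H u ≤ degree G u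
  degree-∖-+ u = count-+ pointwise
    where
    pointwise : ∀ v →
      indicator (adj G u v ∧ not (adj H u v)) + indicator (adj H u v) ≤ indicator (adj G u v)
    pointwise v with adj H u v in uv∈H
    ... | true rewrite H⊆G u v uv∈H = ≤-refl
    ... | false with adj G u v
    ...   | true  = ≤-refl
    ...   | false = z≤n

  degree-spanning : ∀ u → degree H u ≤ degree G u
  degree-spanning u = ≤-trans (m≤n+m _ _) (degree-∖-+ u)

adjacent⇒≢ : ∀ {n} (G : Graph n) {u v} → adj G u v ≡ true → u ≢ v
adjacent⇒≢ G {u} uv∈G refl = contradiction (trans (sym uv∈G) (irref G u)) λ ()

connected⇒degree≥1 : ∀ {n} {H : Graph n} → Connected H → ∀ {u v} → u ≢ v → 1 ≤ degree H u
connected⇒degree≥1 {H = H} conn {u} {v} u≢v with conn u v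
... | here               = contradiction refl u≢v
... | step {v = w} uw _  = ∃⇒count≥1 {p = adj H u} w uw

almostMajority⇒spanningMajority : ∀ {n a} {G H : Graph n} → MinDegreeAtLeast G 2 → SpanningSubgraph H G →
  (c : EdgeColoring H a) → IsAlmostMajority c → ∀ u β → 2 * colorDegree c u β ≤ degree G u
almostMajority⇒spanningMajority {G = G} {H} δ≥2 H⊆G c almost u β with 2 ≤? degree H u
... | yes deg≥2 = ≤-trans (almost u deg≥2 β) (degree-spanning {G = G} {H} H⊆G u)
... | no  deg<2 = ≤-trans (*-monoʳ-≤ 2 cd≤1) (δ≥2 u)
  where
  cd≤1 : colorDegree c u β ≤ 1
  cd≤1 = ≤-trans (countOf≤count (adj H u) (col c u) β) (≤-pred (≰⇒> deg<2))

≟-injective : ∀ {k l} {f : Fin k → Fin l} → (∀ {x y} → f x ≡ f y → x ≡ y) →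
  ∀ x y → ⌊ f x ≟ f y ⌋ ≡ ⌊ x ≟ y ⌋
≟-injective {f = f} f-inj x y with x ≟ y | f x ≟ f y
... | yes _    | yes _     = refl
... | no  _    | no  _     = refl
... | yes refl | no  fx≢fx = contradiction refl fx≢fx
... | no  x≢y  | yes fx≡fy = contradiction (f-inj fx≡fy) x≢y

≟-distinct : ∀ {k} {x y : Fin k} → x ≢ y → ⌊ x ≟ y ⌋ ≡ false
≟-distinct {x = x} {y} x≢y with x ≟ y
... | yes x≡y = contradiction x≡y x≢y
... | no  _   = refl

↑ˡ≢↑ʳ : ∀ {a b} (x : Fin a) (y : Fin b) → x ↑ˡ b ≢ a ↑ʳ y
↑ˡ≢↑ʳ {a} {b} x y eq
  with () ← trans (sym (splitAt-↑ˡ a x b)) (trans (cong (splitAt a) eq) (splitAt-↑ʳ a b y))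

module Overlay {n a b} {G H : Graph n} (c : EdgeColoring H a) (d : EdgeColoring (G ∖ H) b) where

  overlayCol : Fin n → Fin n → Fin (a + b)
  overlayCol u v = if adj H u v then col c u v ↑ˡ b else a ↑ʳ col d u v

  overlayCol-sym : ∀ u v → adj G u v ≡ true → overlayCol u v ≡ overlayCol v u
  overlayCol-sym u v uv∈G with adj H u v in uv∈H | adj H v u in vu∈H
  ... | true  | true  = cong (_↑ˡ b) (colSym c u v uv∈H)
  ... | false | false = cong (a ↑ʳ_) (colSym d u v (cong₂ (λ g h → g ∧ not h) uv∈G uv∈H))
  ... | true  | false = contradiction (trans (sym uv∈H) (trans (Graph.sym H u v) vu∈H)) λ ()
  ... | false | true  = contradiction (trans (sym uv∈H) (trans (Graph.sym H u v) vu∈H)) λ ()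

  overlay : EdgeColoring G (a + b)
  overlay = record { col = overlayCol ; colSym = overlayCol-sym }

  overlayCol-adj : ∀ {u v u′ v′} → overlayCol u v ≡ overlayCol u′ v′ → adj H u v ≡ adj H u′ v′
  overlayCol-adj {u} {v} {u′} {v′} eq with adj H u v | adj H u′ v′
  ... | true  | true  = refl
  ... | false | false = refl
  ... | true  | false = contradiction eq (↑ˡ≢↑ʳ _ _)
  ... | false | true  = contradiction (sym eq) (↑ˡ≢↑ʳ _ _)

  colorDegree-↑ˡ : ∀ u β → colorDegree overlay u (β ↑ˡ b) ≤ colorDegree c u β
  colorDegree-↑ˡ u β = count-mono pointwise
    where
    pointwise : ∀ v → indicator (adj G u v ∧ ⌊ overlayCol u v ≟ β ↑ˡ b ⌋) ≤
                      indicator (adj H u v ∧ ⌊ col c u v ≟ β ⌋)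
    pointwise v with adj H u v
    ... | true  rewrite ≟-injective (↑ˡ-injective b _ _) (col c u v) β = indicator-∧ʳ (adj G u v) _
    ... | false rewrite ≟-distinct (↑ˡ≢↑ʳ β (col d u v) ∘ sym) =
      indicator-∧ʳ (adj G u v) false

  colorDegree-↑ʳ : ∀ u γ → colorDegree overlay u (a ↑ʳ γ) ≤ colorDegree d u γ
  colorDegree-↑ʳ u γ = count-mono pointwise
    where
    pointwise : ∀ v → indicator (adj G u v ∧ ⌊ overlayCol u v ≟ a ↑ʳ γ ⌋) ≤
                      indicator ((adj G u v ∧ not (adj H u v)) ∧ ⌊ col d u v ≟ γ ⌋)
    pointwise v with adj G u v | adj H u v
    ... | false | _     = z≤n
    ... | true  | true  rewrite ≟-distinct (↑ˡ≢↑ʳ (col c u v) γ) = z≤n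
    ... | true  | false rewrite ≟-injective (↑ʳ-injective a _ _) (col d u v) γ = ≤-refl

  overlay-automorphism : SpanningSubgraph H G → ∀ φ → IsAutomorphism G φ →
    (∀ u v → adj G u v ≡ true → overlayCol (φ ⟨$⟩ʳ u) (φ ⟨$⟩ʳ v) ≡ overlayCol u v) →
    IsAutomorphism H φ
  overlay-automorphism H⊆G φ aut preserves u v with adj G u v in uv∈G
  ... | true  = overlayCol-adj (preserves u v uv∈G)
  ... | false = trans (nonadjacent-spanning {G = G} {H} H⊆G (trans (aut u v) uv∈G))
                      (sym (nonadjacent-spanning {G = G} {H} H⊆G uv∈G))

lemma8 : ∀ {n : ℕ} (G H : Graph n) (a : ℕ) →
    MinDegreeAtLeast G 2 →
    SpanningSubgraph H G → Connected H → IsAsymmetric H →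
    (c : EdgeColoring H a) → IsAlmostMajority c →
    MD'≤ G (a + 3)
lemma8 G H a δ≥2 H⊆G conn asym c almost = overlay , majority , distinguishing
  where
  F : Σ (EdgeColoring (G ∖ H) 3) IsNearMajority
  F = nearMajority3 (G ∖ H)
  open Overlay c (proj₁ F)

  H-degree≥1 : ∀ u → 1 ≤ degree H u
  H-degree≥1 u with count≥1⇒∃ (adj G u) (≤-trans (s≤s z≤n) (δ≥2 u))
  ... | v , uv∈G = connected⇒degree≥1 conn (adjacent⇒≢ G uv∈G)

  majority : IsMajority overlay
  majority u α with splitAt a α in α≡
  ... | inj₁ β rewrite sym (splitAt⁻¹-↑ˡ α≡) =
    ≤-trans (*-monoʳ-≤ 2 (colorDegree-↑ˡ u β))
            (almostMajority⇒spanningMajority {G = G} δ≥2 H⊆G c almost u β)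
  ... | inj₂ γ rewrite sym (splitAt⁻¹-↑ʳ α≡) = begin
    2 * colorDegree overlay u (a ↑ʳ γ)   ≤⟨ *-monoʳ-≤ 2 (colorDegree-↑ʳ u γ) ⟩
    2 * colorDegree (proj₁ F) u γ        ≤⟨ proj₂ F u γ ⟩
    degree (G ∖ H) u + 1                 ≤⟨ +-monoʳ-≤ _ (H-degree≥1 u) ⟩
    degree (G ∖ H) u + degree H u        ≤⟨ degree-∖-+ {G = G} {H} H⊆G u ⟩
    degree G u ∎
    where open ≤-Reasoning

  distinguishing : IsDistinguishing overlay
  distinguishing φ aut preserves = asym φ (overlay-automorphism H⊆G φ aut preserves)
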